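{- Let $q$ be a prime power, $r^*=q^3-q$, $u^*=q^3+q^2$, and for integers $r,s,t,u$ let $\Omega_{r,s,t,u}$ be as in the context. For integers $r\ge r^*$, $u\ge u^*$ and $0\le s,t<q+1$, \[\#\Omega_{r,s,t,u}=\#\Omega_{r^*,s,t,u^*}+(r-r^*)+(u-u^*).\]
   Context: $q$ is a power of a prime. For integers $r,s,t,u$, $\Omega_{r,s,t,u}=\{(i,j,k)\in\mathbb{Z}^3: -r\le i,\ -s\le i+(q^2+q)k<-s+(q^2+q),\ -t\le qi+(q^2+q)j+(q+1)k<-t+(q^2+q),\ -u\le -q^2i-(q^3-q)j-(q^3+q^2-q-1)k\}$. -}

module Defs where

open import Data.Nat as ℕ using (ℕ; suc)
open import Data.Nat.Primality using (Prime)
open import Data.Integer using (ℤ; +_; _+_; _-_; _*_; -_; _≤_; _<_)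
open import Data.Product using (Σ; _×_; _,_; ∃)
open import Relation.Binary.PropositionalEquality using (_≡_)

IsPrimePower : ℕ → Set
IsPrimePower q = Σ ℕ λ p → Σ ℕ λ k → Prime p × (q ≡ p ℕ.^ suc k)

InΩ : ℕ → ℤ → ℤ → ℤ → ℤ → ℤ → ℤ → ℤ → Set
InΩ q r s t u i j k =
  let Q = + q in
  (- r ≤ i)
  × (- s ≤ i + (Q * Q + Q) * k)
  × (i + (Q * Q + Q) * k < - s + (Q * Q + Q))
  × (- t ≤ Q * i + (Q * Q + Q) * j + (Q + + 1) * k)
  × (Q * i + (Q * Q + Q) * j + (Q + + 1) * k < - t + (Q * Q + Q))
  × (- u ≤ - (Q * Q) * i - (Q * Q * Q - Q) * j - (Q * Q * Q + Q * Q - Q - + 1) * k)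

Ω : ℕ → ℤ → ℤ → ℤ → ℤ → Set
Ω q r s t u = Σ (ℤ × ℤ × ℤ) λ { (i , j , k) → InΩ q r s t u i j k }

rStar : ℕ → ℤ
rStar q = (+ q) * (+ q) * (+ q) - + q

uStar : ℕ → ℤ
uStar q = (+ q) * (+ q) * (+ q) + (+ q) * (+ q)

-- A point (i, j, k) is windowed when x = i + (q²+q)k and y = qi + (q²+q)j + (q+1)k lie in the
-- windows [-s, -s+q²+q) and [-t, -t+q²+q); Ω_{r,s,t,u} consists of the windowed points with
-- i ≥ -r and w ≥ -u, w being the last linear form. Choosing k and then j by floor division shows
-- that a windowed point is determined by i, which takes every integer value exactly once; after a
-- unimodular change of coordinates the same holds for w. Since i + w = -(q-1)(x+y), the sum i + w
-- lies between two constants, and the lower one is at least -r* - u*: no windowed point has both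
-- i < -r* and w < -u*. Hence enlarging r beyond r* adds exactly the points with -r ≤ i < -r*,
-- enlarging u beyond u* those with -u ≤ w < -u*, and the upper constant bounds i on
-- Ω_{r*,s,t,u*}, which is therefore finite.

module Submission where

open import Defs
open import Level using (0ℓ)
open import Data.Nat as ℕ using (ℕ; zero; suc)
open import Data.Nat.Properties using (m^n≢0)
open import Data.Nat.Primality using (prime⇒nonZero)
open import Data.Integer using (ℤ; +_; _+_; _-_; _*_; -_; _≤_; _<_; +≤+; +<+; ∣_∣)
open import Data.Integer.Base using (_/_; _%_; >-nonZero; nonNegative)
open import Data.Integer.Properties
open import Data.Integer.DivMod using (a≡a%n+[a/n]*n; n%d<d)
open import Data.Integer.Tactic.RingSolver using (solve-∀; solve)
open import Data.List using (_∷_; [])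
open import Data.Fin as Fin using (Fin; toℕ; fromℕ<)
open import Data.Fin.Properties using (toℕ-fromℕ<; toℕ-injective; toℕ<n; +↔⊎)
open import Data.Product using (Σ; ∃; ∃!; _×_; _,_; proj₁; proj₂; map; map₂)
open import Data.Product.Algebra using (×-cong; ×-comm)
open import Data.Product.Properties using (Σ-≡,≡→≡)
open import Data.Product.Function.Dependent.Propositional using (Σ-↔)
open import Data.Sum using (_⊎_; inj₁; inj₂)
open import Data.Sum.Function.Propositional using (_⊎-↔_)
open import Function.Base using (id)
open import Function.Bundles using (_↔_; mk↔ₛ′; Inverse)
open import Function.Properties.Inverse using (↔-refl; ↔-sym; ↔-trans)
open import Relation.Binary.Definitions using (tri<; tri≈; tri>)
open import Relation.Binary.PropositionalEquality
open import Relation.Nullary using (yes; no; contradiction)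
open import Relation.Unary using (Pred; Decidable; Irrelevant)

infix 4 _∈[_,_⟩

_∈[_,_⟩ : ℤ → ℤ → ℤ → Set
v ∈[ lo , hi ⟩ = lo ≤ v × v < hi

∈[,⟩-irrelevant : ∀ {lo hi} → Irrelevant (_∈[ lo , hi ⟩)
∈[,⟩-irrelevant (a , b) (a′ , b′) = cong₂ _,_ (≤-irrelevant a a′) (<-irrelevant b b′)

∈[,⟩-cong : ∀ {lo hi v v′} → v ≡ v′ → (v ∈[ lo , hi ⟩) ↔ (v′ ∈[ lo , hi ⟩)
∈[,⟩-cong refl = ↔-refl

+∣j-i∣≡j-i : ∀ {i j} → i ≤ j → + ∣ j - i ∣ ≡ j - i
+∣j-i∣≡j-i i≤j = 0≤i⇒+∣i∣≡i (i≤j⇒0≤j-i i≤j)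

Fin↔interval : ∀ lo n → Fin n ↔ Σ ℤ (_∈[ lo , lo + + n ⟩)
Fin↔interval lo n = mk↔ₛ′ to from to∘from from∘to
  where
  lo+[z-lo]≡z : ∀ lo z → lo + (z - lo) ≡ z
  lo+[z-lo]≡z = solve-∀
  [lo+m]-lo≡m : ∀ lo m → lo + m - lo ≡ m
  [lo+m]-lo≡m = solve-∀

  to : Fin n → Σ ℤ (_∈[ lo , lo + + n ⟩)
  to f = lo + + toℕ f , i≤i+j lo (+ toℕ f) , +-monoʳ-< lo (+<+ (toℕ<n f))

  offset< : ∀ {z} → z ∈[ lo , lo + + n ⟩ → ∣ z - lo ∣ ℕ.< n
  offset< {z} (lo≤z , z<lo+n) = drop‿+<+ (begin-strict
    + ∣ z - lo ∣      ≡⟨ +∣j-i∣≡j-i lo≤z ⟩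
    z - lo            <⟨ +-monoˡ-< (- lo) z<lo+n ⟩
    lo + + n - lo     ≡⟨ [lo+m]-lo≡m lo (+ n) ⟩
    + n               ∎)
    where open ≤-Reasoning

  from : Σ ℤ (_∈[ lo , lo + + n ⟩) → Fin n
  from (z , h) = fromℕ< (offset< h)

  to∘from : ∀ x → to (from x) ≡ x
  to∘from (z , h) = Σ-≡,≡→≡ (lo+offset , ∈[,⟩-irrelevant _ h)
    where
    lo+offset : lo + + toℕ (fromℕ< (offset< h)) ≡ z
    lo+offset = begin
      lo + + toℕ (fromℕ< (offset< h))  ≡⟨ cong (λ m → lo + + m) (toℕ-fromℕ< (offset< h)) ⟩
      lo + + ∣ z - lo ∣                ≡⟨ cong (λ m → lo + m) (+∣j-i∣≡j-i (proj₁ h)) ⟩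
      lo + (z - lo)                    ≡⟨ lo+[z-lo]≡z lo z ⟩
      z                                ∎
      where open ≡-Reasoning

  from∘to : ∀ f → from (to f) ≡ f
  from∘to f = toℕ-injective (begin
    toℕ (from (to f))                ≡⟨ toℕ-fromℕ< _ ⟩
    ∣ lo + + toℕ f - lo ∣            ≡⟨ cong ∣_∣ ([lo+m]-lo≡m lo (+ toℕ f)) ⟩
    toℕ f                            ∎)
    where open ≡-Reasoning

Fin↔interval′ : ∀ {lo hi} → lo ≤ hi → Fin ∣ hi - lo ∣ ↔ Σ ℤ (_∈[ lo , hi ⟩)
Fin↔interval′ {lo} {hi} lo≤hi = subst (λ h → Fin ∣ hi - lo ∣ ↔ Σ ℤ (_∈[ lo , h ⟩)) lo+[hi-lo]≡hi
                                       (Fin↔interval lo ∣ hi - lo ∣)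
  where
  lo+[hi-lo]≡hi : lo + + ∣ hi - lo ∣ ≡ hi
  lo+[hi-lo]≡hi = trans (cong (λ m → lo + m) (+∣j-i∣≡j-i lo≤hi)) (solve (lo ∷ hi ∷ []))

j≤i+∣j-i∣ : ∀ i j → j ≤ i + + ∣ j - i ∣
j≤i+∣j-i∣ i j with ≤-total i j
... | inj₁ i≤j = ≤-reflexive (begin
  j                  ≡⟨ solve (i ∷ j ∷ []) ⟩
  i + (j - i)        ≡⟨ cong (λ m → i + m) (+∣j-i∣≡j-i i≤j) ⟨
  i + + ∣ j - i ∣    ∎)
  where open ≡-Reasoning
... | inj₂ j≤i = ≤-trans j≤i (i≤i+j i (+ ∣ j - i ∣))

finite-decidable-subset-Fin : ∀ {n} {P : Pred (Fin n) 0ℓ} → Decidable P → Irrelevant P →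
                              ∃ λ m → Fin m ↔ Σ (Fin n) P
finite-decidable-subset-Fin {zero} _ _ = 0 , mk↔ₛ′ (λ ()) (λ { (() , _) }) (λ { (() , _) }) (λ ())
finite-decidable-subset-Fin {suc n} {P} P? P-irr
  with finite-decidable-subset-Fin (λ f → P? (Fin.suc f)) P-irr | P? Fin.zero
... | m , e | yes p₀ = suc m , mk↔ₛ′ to from to∘from from∘to
  where
  open Inverse e using () renaming (to to toₑ; from to fromₑ)
  to : Fin (suc m) → Σ (Fin (suc n)) P
  to Fin.zero    = Fin.zero , p₀
  to (Fin.suc x) = map Fin.suc id (toₑ x)
  from : Σ (Fin (suc n)) P → Fin (suc m)
  from (Fin.zero  , _) = Fin.zero
  from (Fin.suc f , p) = Fin.suc (fromₑ (f , p))
  to∘from : ∀ y → to (from y) ≡ y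
  to∘from (Fin.zero  , p) = cong (Fin.zero ,_) (P-irr p₀ p)
  to∘from (Fin.suc f , p) = cong (map Fin.suc id) (Inverse.strictlyInverseˡ e (f , p))
  from∘to : ∀ x → from (to x) ≡ x
  from∘to Fin.zero    = refl
  from∘to (Fin.suc x) = cong Fin.suc (Inverse.strictlyInverseʳ e x)
... | m , e | no ¬p₀ = m , mk↔ₛ′ to from to∘from (Inverse.strictlyInverseʳ e)
  where
  open Inverse e using () renaming (to to toₑ; from to fromₑ)
  to : Fin m → Σ (Fin (suc n)) P
  to x = map Fin.suc id (toₑ x)
  from : Σ (Fin (suc n)) P → Fin m
  from (Fin.zero  , p) = contradiction p ¬p₀
  from (Fin.suc f , p) = fromₑ (f , p)
  to∘from : ∀ y → to (from y) ≡ y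
  to∘from (Fin.zero  , p) = contradiction p ¬p₀
  to∘from (Fin.suc f , p) = cong (map Fin.suc id) (Inverse.strictlyInverseˡ e (f , p))

finite-decidable-subset : ∀ {n} {X : Set} {P : Pred X 0ℓ} → Fin n ↔ X → Decidable P → Irrelevant P →
                          ∃ λ m → Fin m ↔ Σ X P
finite-decidable-subset e P? P-irr with finite-decidable-subset-Fin (λ f → P? (Inverse.to e f)) P-irr
... | m , filtered = m , ↔-trans filtered (Σ-↔ e ↔-refl)

window-∃! : ∀ {D} → + 0 < D → ∀ c n → ∃! _≡_ (λ z → n + D * z ∈[ c , c + D ⟩)
window-∃! {D} 0<D c n = z₀ , in-window , λ {z} → unique z
  where
  instance
    _ = >-nonZero 0<D
    _ = nonNegative (<⇒≤ 0<D)

  z₀ : ℤ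
  z₀ = - ((n - c) / D)

  r : ℕ
  r = (n - c) % D

  n+Dz₀≡c+r : n + D * z₀ ≡ c + + r
  n+Dz₀≡c+r = begin
    n + D * z₀                     ≡⟨ rearrange n c ((n - c) / D) D ⟩
    c + (n - c - (n - c) / D * D)  ≡⟨ cong (λ m → c + (m - (n - c) / D * D)) (a≡a%n+[a/n]*n (n - c) D) ⟩
    c + (+ r + (n - c) / D * D - (n - c) / D * D) ≡⟨ cong (λ m → c + m) (cancel (+ r) ((n - c) / D * D)) ⟩
    c + + r                        ∎
    where
    open ≡-Reasoning
    rearrange : ∀ n c X D → n + D * (- X) ≡ c + (n - c - X * D)
    rearrange = solve-∀
    cancel : ∀ m X → m + X - X ≡ m
    cancel = solve-∀

  r<D : + r < D
  r<D = <-≤-trans (+<+ (n%d<d (n - c) D)) (≤-reflexive (0≤i⇒+∣i∣≡i (<⇒≤ 0<D)))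

  in-window : n + D * z₀ ∈[ c , c + D ⟩
  in-window rewrite n+Dz₀≡c+r = i≤i+j c (+ r) , +-monoʳ-< c r<D

  above-window : ∀ {z z′} → c ≤ n + D * z → z < z′ → c + D ≤ n + D * z′
  above-window {z} {z′} c≤ z<z′ = begin
    c + D              ≤⟨ +-monoˡ-≤ D c≤ ⟩
    n + D * z + D      ≡⟨ step n D z ⟩
    n + D * (+ 1 + z)  ≤⟨ +-monoʳ-≤ n (*-monoˡ-≤-nonNeg D (i<j⇒suc[i]≤j z<z′)) ⟩
    n + D * z′         ∎
    where
    open ≤-Reasoning
    step : ∀ n D z → n + D * z + D ≡ n + D * (+ 1 + z)
    step = solve-∀

  unique : ∀ z → n + D * z ∈[ c , c + D ⟩ → z₀ ≡ z
  unique z (c≤ , <c+D) with <-cmp z₀ z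
  ... | tri< z₀<z _ _ = contradiction (above-window (proj₁ in-window) z₀<z) (<⇒≱ <c+D)
  ... | tri≈ _ z₀≡z _ = z₀≡z
  ... | tri> _ _ z<z₀ = contradiction (above-window c≤ z<z₀) (<⇒≱ (proj₂ in-window))

module Staircase {D : ℤ} (0<D : + 0 < D) (lo₁ lo₂ : ℤ) (e : ℤ → ℤ → ℤ) where

  Steps : ℤ × ℤ × ℤ → Set
  Steps (v , c₁ , c₂) = v + D * c₁ ∈[ lo₁ , lo₁ + D ⟩ × e v c₁ + D * c₂ ∈[ lo₂ , lo₂ + D ⟩

  staircase↔ℤ : Σ (ℤ × ℤ × ℤ) Steps ↔ ℤ
  staircase↔ℤ = mk↔ₛ′ (λ p → proj₁ (proj₁ p)) from (λ _ → refl) from∘to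
    where
    first : ℤ → ℤ
    first v = proj₁ (window-∃! 0<D lo₁ v)
    second : ℤ → ℤ
    second v = proj₁ (window-∃! 0<D lo₂ (e v (first v)))

    from : ℤ → Σ (ℤ × ℤ × ℤ) Steps
    from v = (v , first v , second v)
           , proj₁ (proj₂ (window-∃! 0<D lo₁ v))
           , proj₁ (proj₂ (window-∃! 0<D lo₂ (e v (first v))))

    from∘to : ∀ p → from (proj₁ (proj₁ p)) ≡ p
    from∘to ((v , c₁ , c₂) , h₁ , h₂) =
      Σ-≡,≡→≡ (cong (v ,_) (cong₂ _,_ first≡c₁ second≡c₂) , steps-irrelevant _ _)
      where
      first≡c₁ : first v ≡ c₁
      first≡c₁ = proj₂ (proj₂ (window-∃! 0<D lo₁ v)) h₁
      second≡c₂ : second v ≡ c₂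
      second≡c₂ = proj₂ (proj₂ (window-∃! 0<D lo₂ (e v (first v))))
                    (subst (λ c → e v c + D * c₂ ∈[ lo₂ , lo₂ + D ⟩) (sym first≡c₁) h₂)
      steps-irrelevant : Irrelevant Steps
      steps-irrelevant (a₁ , a₂) (b₁ , b₂) = cong₂ _,_ (∈[,⟩-irrelevant a₁ b₁) (∈[,⟩-irrelevant a₂ b₂)

i+j≤k+l∧k<i⇒j≤l : ∀ {i j k l} → i + j ≤ k + l → k < i → j ≤ l
i+j≤k+l∧k<i⇒j≤l i+j≤k+l k<i = ≮⇒≥ λ l<j → ≤⇒≯ i+j≤k+l (+-mono-< k<i l<j)

module Regions {T : Set} (A B : T ↔ ℤ) where

  open Inverse A using () renaming (to to a)
  open Inverse B using () renaming (to to b)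

  Region : ℤ → ℤ → Set
  Region α β = Σ T λ p → α ≤ a p × β ≤ b p

  region-split : ∀ {α β α′ β′} → (∀ p → α + β ≤ a p + b p) → α′ ≤ α → β′ ≤ β →
    Region α′ β′ ↔ ((Region α β ⊎ Σ T (λ p → a p ∈[ α′ , α ⟩)) ⊎ Σ T (λ p → b p ∈[ β′ , β ⟩))
  region-split {α} {β} {α′} {β′} sum-bound α′≤α β′≤β = mk↔ₛ′ to from to∘from from∘to
    where
    a-low⇒b-high : ∀ p → a p < α → β ≤ b p
    a-low⇒b-high p = i+j≤k+l∧k<i⇒j≤l (sum-bound p)

    b-low⇒a-high : ∀ p → b p < β → α ≤ a p
    b-low⇒a-high p = i+j≤k+l∧k<i⇒j≤l (subst₂ _≤_ (+-comm α β) (+-comm (a p) (b p)) (sum-bound p))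

    to : Region α′ β′ → (Region α β ⊎ Σ T (λ p → a p ∈[ α′ , α ⟩)) ⊎ Σ T (λ p → b p ∈[ β′ , β ⟩)
    to (p , α′≤a , β′≤b) with b p <? β | a p <? α
    ... | yes b<β | _       = inj₂ (p , β′≤b , b<β)
    ... | no  b≮β | yes a<α = inj₁ (inj₂ (p , α′≤a , a<α))
    ... | no  b≮β | no  a≮α = inj₁ (inj₁ (p , ≮⇒≥ a≮α , ≮⇒≥ b≮β))

    from : (Region α β ⊎ Σ T (λ p → a p ∈[ α′ , α ⟩)) ⊎ Σ T (λ p → b p ∈[ β′ , β ⟩) → Region α′ β′
    from (inj₁ (inj₁ (p , α≤a , β≤b))) = p , ≤-trans α′≤α α≤a , ≤-trans β′≤β β≤b
    from (inj₁ (inj₂ (p , α′≤a , a<α))) = p , α′≤a , ≤-trans β′≤β (a-low⇒b-high p a<α)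
    from (inj₂ (p , β′≤b , b<β))        = p , ≤-trans α′≤α (b-low⇒a-high p b<β) , β′≤b

    to∘from : ∀ y → to (from y) ≡ y
    to∘from (inj₁ (inj₁ (p , α≤a , β≤b))) with b p <? β | a p <? α
    ... | yes b<β | _       = contradiction β≤b (<⇒≱ b<β)
    ... | no  _   | yes a<α = contradiction α≤a (<⇒≱ a<α)
    ... | no  _   | no  _   = cong (λ h → inj₁ (inj₁ (p , h))) (cong₂ _,_ (≤-irrelevant _ _) (≤-irrelevant _ _))
    to∘from (inj₁ (inj₂ (p , α′≤a , a<α))) with b p <? β | a p <? α
    ... | yes b<β | _       = contradiction (a-low⇒b-high p a<α) (<⇒≱ b<β)
    ... | no  _   | yes _   = cong (λ h → inj₁ (inj₂ (p , α′≤a , h))) (<-irrelevant _ _)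
    ... | no  _   | no  a≮α = contradiction a<α a≮α
    to∘from (inj₂ (p , β′≤b , b<β)) with b p <? β
    ... | yes _   = cong (λ h → inj₂ (p , β′≤b , h)) (<-irrelevant _ _)
    ... | no  b≮β = contradiction b<β b≮β

    from∘to : ∀ x → from (to x) ≡ x
    from∘to (p , α′≤a , β′≤b) with b p <? β | a p <? α
    ... | yes _ | _     = cong (λ h → p , h , β′≤b) (≤-irrelevant _ _)
    ... | no  _ | yes _ = cong (λ h → p , α′≤a , h) (≤-irrelevant _ _)
    ... | no  _ | no  _ = cong (p ,_) (cong₂ _,_ (≤-irrelevant _ _) (≤-irrelevant _ _))

  region-finite : ∀ {α β U} → (∀ p → a p + b p ≤ U) → ∃ λ m → Fin m ↔ Region α β
  region-finite {α} {β} {U} sum-bound =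
    map₂ (λ e → ↔-trans e bounded) (finite-decidable-subset strip (λ x → β ≤? b (proj₁ x)) ≤-irrelevant)
    where
    hi : ℤ
    hi = + 1 + (U - β)

    N : ℕ
    N = ∣ hi - α ∣

    strip : Fin N ↔ Σ T (λ p → a p ∈[ α , α + + N ⟩)
    strip = ↔-trans (Fin↔interval α N) (↔-sym (Σ-↔ A ↔-refl))

    below-hi : ∀ {x y} → x + y ≤ U → β ≤ y → x < hi
    below-hi {x} {y} x+y≤U β≤y = suc[i]≤j⇒i<j (+-monoʳ-≤ (+ 1) (begin
      x            ≡⟨ solve (x ∷ β ∷ []) ⟩
      x + β - β    ≤⟨ +-monoˡ-≤ (- β) (+-monoʳ-≤ x β≤y) ⟩
      x + y - β    ≤⟨ +-monoˡ-≤ (- β) x+y≤U ⟩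
      U - β        ∎))
      where open ≤-Reasoning

    a<α+N : ∀ p → β ≤ b p → a p < α + + N
    a<α+N p β≤b = <-≤-trans (below-hi (sum-bound p) β≤b) (j≤i+∣j-i∣ α hi)

    bounded : Σ (Σ T (λ p → a p ∈[ α , α + + N ⟩)) (λ x → β ≤ b (proj₁ x)) ↔ Region α β
    bounded = mk↔ₛ′ (λ { ((p , α≤a , _) , β≤b) → p , α≤a , β≤b })
                    (λ { (p , α≤a , β≤b) → (p , α≤a , a<α+N p β≤b) , β≤b })
                    (λ _ → refl)
                    (λ { ((p , α≤a , _) , β≤b) → cong (λ h → (p , α≤a , h) , β≤b) (<-irrelevant _ _) })

  region-count : ∀ {α β α′ β′ U} → (∀ p → α + β ≤ a p + b p) → (∀ p → a p + b p ≤ U) →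
    α′ ≤ α → β′ ≤ β →
    Σ ℕ λ m → Σ ℕ λ n → (Fin m ↔ Region α β) × (Fin n ↔ Region α′ β′) × (+ n ≡ + m + (α - α′) + (β - β′))
  region-count {α} {β} {α′} {β′} lower upper α′≤α β′≤β =
    m , m ℕ.+ k ℕ.+ l , core , pieces , size
    where
    m k l : ℕ
    m = proj₁ (region-finite upper)
    k = ∣ α - α′ ∣
    l = ∣ β - β′ ∣

    core : Fin m ↔ Region α β
    core = proj₂ (region-finite upper)

    pieces : Fin (m ℕ.+ k ℕ.+ l) ↔ Region α′ β′
    pieces = ↔-trans (+↔⊎ {m ℕ.+ k})
           ( ↔-trans ((↔-trans (+↔⊎ {m}) (core ⊎-↔ ↔-trans (Fin↔interval′ α′≤α) (↔-sym (Σ-↔ A ↔-refl))))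
                      ⊎-↔ ↔-trans (Fin↔interval′ β′≤β) (↔-sym (Σ-↔ B ↔-refl)))
           ( ↔-sym (region-split lower α′≤α β′≤β)))

    size : + (m ℕ.+ k ℕ.+ l) ≡ + m + (α - α′) + (β - β′)
    size = begin
      + (m ℕ.+ k ℕ.+ l)      ≡⟨ pos-+ (m ℕ.+ k) l ⟩
      + (m ℕ.+ k) + + l      ≡⟨ cong (_+ + l) (pos-+ m k) ⟩
      + m + + k + + l        ≡⟨ cong₂ (λ x y → + m + x + y) (+∣j-i∣≡j-i α′≤α) (+∣j-i∣≡j-i β′≤β) ⟩
      + m + (α - α′) + (β - β′) ∎
      where open ≡-Reasoning

module Windows (Q : ℤ) (1≤Q : + 1 ≤ Q) (s t : ℤ) where

  D : ℤ
  D = Q * Q + Q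

  x : ℤ → ℤ → ℤ
  x i k = i + D * k

  y : ℤ → ℤ → ℤ → ℤ
  y i j k = Q * i + D * j + (Q + + 1) * k

  w : ℤ → ℤ → ℤ → ℤ
  w i j k = - (Q * Q) * i - (Q * Q * Q - Q) * j - (Q * Q * Q + Q * Q - Q - + 1) * k

  Windowed : ℤ × ℤ × ℤ → Set
  Windowed (i , j , k) = x i k ∈[ - s , - s + D ⟩ × y i j k ∈[ - t , - t + D ⟩

  WindowedPoint : Set
  WindowedPoint = Σ (ℤ × ℤ × ℤ) Windowed

  0≤Q-1 : + 0 ≤ Q - + 1
  0≤Q-1 = i≤j⇒0≤j-i 1≤Q

  0<Q : + 0 < Q
  0<Q = suc[i]≤j⇒i<j 1≤Q

  0<D : + 0 < D
  0<D = begin-strict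
    + 0            <⟨ 0<Q ⟩
    Q              ≡⟨ solve (Q ∷ []) ⟩
    + 0 + Q        ≤⟨ +-monoˡ-≤ Q (*-monoʳ-≤-nonNeg Q (<⇒≤ 0<Q)) ⟩
    Q * Q + Q      ∎
    where
    open ≤-Reasoning
    instance _ = nonNegative (<⇒≤ 0<Q)

  by-i : WindowedPoint ↔ ℤ
  by-i = ↔-trans (Σ-↔ swap windows) staircase↔ℤ
    where
    open Staircase 0<D (- s) (- t) (λ i k → Q * i + (Q + + 1) * k)
    swap : (ℤ × ℤ × ℤ) ↔ (ℤ × ℤ × ℤ)
    swap = mk↔ₛ′ (λ { (i , j , k) → i , k , j }) (λ { (i , k , j) → i , j , k }) (λ _ → refl) (λ _ → refl)
    y≡ : ∀ i j k → Q * i + (Q * Q + Q) * j + (Q + + 1) * k ≡ Q * i + (Q + + 1) * k + (Q * Q + Q) * j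
    y≡ i j k = solve (Q ∷ i ∷ j ∷ k ∷ [])
    windows : ∀ {p} → Windowed p ↔ Steps (Inverse.to swap p)
    windows {i , j , k} = ×-cong ↔-refl (∈[,⟩-cong (y≡ i j k))

  by-w : WindowedPoint ↔ ℤ
  by-w = ↔-trans (Σ-↔ change windows) staircase↔ℤ
    where
    -- With a = i + Qj + Qk and c = -(i + (Q+1)j + k) one has y = w + Da and x = (Q+1)a + Qy + Dc,
    -- so w fixes a through the y-window and then c through the x-window.
    open Staircase 0<D (- t) (- s) (λ v a → (Q + + 1) * a + Q * (v + D * a))
    to : ℤ × ℤ × ℤ → ℤ × ℤ × ℤ
    to (i , j , k) = w i j k , i + Q * j + Q * k , - (i + (Q + + 1) * j + k)

    from : ℤ × ℤ × ℤ → ℤ × ℤ × ℤ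
    from (v , a , c) = (Q + + 1) * a - Q * Q * (v + D * a) - (Q * Q * Q - Q) * c
                     , - c - a + (Q - + 1) * (v + D * a + Q * c)
                     , v + D * a + Q * c

    to∘from : ∀ v a c → to (from (v , a , c)) ≡ (v , a , c)
    to∘from v a c = cong₂ _,_ w≡ (cong₂ _,_ a≡ c≡)
      where
      w≡ : - (Q * Q) * ((Q + + 1) * a - Q * Q * (v + (Q * Q + Q) * a) - (Q * Q * Q - Q) * c)
           - (Q * Q * Q - Q) * (- c - a + (Q - + 1) * (v + (Q * Q + Q) * a + Q * c))
           - (Q * Q * Q + Q * Q - Q - + 1) * (v + (Q * Q + Q) * a + Q * c) ≡ v
      w≡ = solve (Q ∷ v ∷ a ∷ c ∷ [])
      a≡ : (Q + + 1) * a - Q * Q * (v + (Q * Q + Q) * a) - (Q * Q * Q - Q) * c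
           + Q * (- c - a + (Q - + 1) * (v + (Q * Q + Q) * a + Q * c))
           + Q * (v + (Q * Q + Q) * a + Q * c) ≡ a
      a≡ = solve (Q ∷ v ∷ a ∷ c ∷ [])
      c≡ : - ((Q + + 1) * a - Q * Q * (v + (Q * Q + Q) * a) - (Q * Q * Q - Q) * c
              + (Q + + 1) * (- c - a + (Q - + 1) * (v + (Q * Q + Q) * a + Q * c))
              + (v + (Q * Q + Q) * a + Q * c)) ≡ c
      c≡ = solve (Q ∷ v ∷ a ∷ c ∷ [])

    from∘to : ∀ i j k → from (to (i , j , k)) ≡ (i , j , k)
    from∘to i j k = cong₂ _,_ i≡ (cong₂ _,_ j≡ k≡)
      where
      i≡ : (Q + + 1) * (i + Q * j + Q * k)
           - Q * Q * (- (Q * Q) * i - (Q * Q * Q - Q) * j - (Q * Q * Q + Q * Q - Q - + 1) * k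
                      + (Q * Q + Q) * (i + Q * j + Q * k))
           - (Q * Q * Q - Q) * - (i + (Q + + 1) * j + k) ≡ i
      i≡ = solve (Q ∷ i ∷ j ∷ k ∷ [])
      j≡ : - - (i + (Q + + 1) * j + k) - (i + Q * j + Q * k)
           + (Q - + 1) * (- (Q * Q) * i - (Q * Q * Q - Q) * j - (Q * Q * Q + Q * Q - Q - + 1) * k
                          + (Q * Q + Q) * (i + Q * j + Q * k) + Q * - (i + (Q + + 1) * j + k)) ≡ j
      j≡ = solve (Q ∷ i ∷ j ∷ k ∷ [])
      k≡ : - (Q * Q) * i - (Q * Q * Q - Q) * j - (Q * Q * Q + Q * Q - Q - + 1) * k
           + (Q * Q + Q) * (i + Q * j + Q * k) + Q * - (i + (Q + + 1) * j + k) ≡ k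
      k≡ = solve (Q ∷ i ∷ j ∷ k ∷ [])

    change : (ℤ × ℤ × ℤ) ↔ (ℤ × ℤ × ℤ)
    change = mk↔ₛ′ to from (λ { (v , a , c) → to∘from v a c }) (λ { (i , j , k) → from∘to i j k })

    windows : ∀ {p} → Windowed p ↔ Steps (to p)
    windows {i , j , k} = ↔-trans (×-comm _ _) (×-cong (∈[,⟩-cong y≡) (∈[,⟩-cong x≡))
      where
      y≡ : Q * i + (Q * Q + Q) * j + (Q + + 1) * k
           ≡ - (Q * Q) * i - (Q * Q * Q - Q) * j - (Q * Q * Q + Q * Q - Q - + 1) * k
             + (Q * Q + Q) * (i + Q * j + Q * k)
      y≡ = solve (Q ∷ i ∷ j ∷ k ∷ [])
      x≡ : i + (Q * Q + Q) * k
           ≡ (Q + + 1) * (i + Q * j + Q * k)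
             + Q * (- (Q * Q) * i - (Q * Q * Q - Q) * j - (Q * Q * Q + Q * Q - Q - + 1) * k
                    + (Q * Q + Q) * (i + Q * j + Q * k))
             + (Q * Q + Q) * - (i + (Q + + 1) * j + k)
      x≡ = solve (Q ∷ i ∷ j ∷ k ∷ [])

  window-bounds : ∀ {c v} → + 0 ≤ c → c < Q + + 1 → v ∈[ - c , - c + D ⟩ → - (Q + + 1) ≤ v × v ≤ D
  window-bounds {c} {v} 0≤c c<Q+1 (-c≤v , v<-c+D) = ≤-trans (neg-mono-≤ (<⇒≤ c<Q+1)) -c≤v , (begin
    v          <⟨ v<-c+D ⟩
    - c + D    ≤⟨ +-monoˡ-≤ D (neg-mono-≤ 0≤c) ⟩
    + 0 + D    ≡⟨ +-identityˡ D ⟩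
    D          ∎)
    where open ≤-Reasoning

  i+w≡-[Q-1][x+y] : ∀ i j k → i + w i j k ≡ - ((Q - + 1) * (x i k + y i j k))
  i+w≡-[Q-1][x+y] i j k = identity
    where
    identity : i + (- (Q * Q) * i - (Q * Q * Q - Q) * j - (Q * Q * Q + Q * Q - Q - + 1) * k)
               ≡ - ((Q - + 1) * ((i + (Q * Q + Q) * k) + (Q * i + (Q * Q + Q) * j + (Q + + 1) * k)))
    identity = solve (Q ∷ i ∷ j ∷ k ∷ [])

  i+w-bounds : + 0 ≤ s → s < Q + + 1 → + 0 ≤ t → t < Q + + 1 → ∀ {i j k} → Windowed (i , j , k) →
               - ((Q - + 1) * (D + D)) ≤ i + w i j k × i + w i j k ≤ (Q - + 1) * ((Q + + 1) + (Q + + 1))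
  i+w-bounds 0≤s s<Q+1 0≤t t<Q+1 {i} {j} {k} (x-window , y-window) = lower , upper
    where
    instance _ = nonNegative 0≤Q-1
    x-bounds : - (Q + + 1) ≤ x i k × x i k ≤ D
    x-bounds = window-bounds 0≤s s<Q+1 x-window
    y-bounds : - (Q + + 1) ≤ y i j k × y i j k ≤ D
    y-bounds = window-bounds 0≤t t<Q+1 y-window
    lower : - ((Q - + 1) * (D + D)) ≤ i + w i j k
    lower = begin
      - ((Q - + 1) * (D + D))             ≤⟨ neg-mono-≤ (*-monoˡ-≤-nonNeg (Q - + 1)
                                                (+-mono-≤ (proj₂ x-bounds) (proj₂ y-bounds))) ⟩
      - ((Q - + 1) * (x i k + y i j k))   ≡⟨ i+w≡-[Q-1][x+y] i j k ⟨
      i + w i j k                         ∎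
      where open ≤-Reasoning
    upper : i + w i j k ≤ (Q - + 1) * ((Q + + 1) + (Q + + 1))
    upper = begin
      i + w i j k                                  ≡⟨ i+w≡-[Q-1][x+y] i j k ⟩
      - ((Q - + 1) * (x i k + y i j k))            ≤⟨ neg-mono-≤ (*-monoˡ-≤-nonNeg (Q - + 1)
                                                       (+-mono-≤ (proj₁ x-bounds) (proj₁ y-bounds))) ⟩
      - ((Q - + 1) * (- (Q + + 1) + - (Q + + 1)))  ≡⟨ solve (Q ∷ []) ⟩
      (Q - + 1) * ((Q + + 1) + (Q + + 1))          ∎
      where open ≤-Reasoning

  -r*-u*≤-[Q-1][D+D] : - (Q * Q * Q - Q) + - (Q * Q * Q + Q * Q) ≤ - ((Q - + 1) * (D + D))
  -r*-u*≤-[Q-1][D+D] = begin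
    - (Q * Q * Q - Q) + - (Q * Q * Q + Q * Q)             ≤⟨ i≤i+j _ D ⟩
    - (Q * Q * Q - Q) + - (Q * Q * Q + Q * Q) + D         ≡⟨ identity ⟩
    - ((Q - + 1) * (D + D))                               ∎
    where
    open ≤-Reasoning
    instance _ = nonNegative (<⇒≤ 0<D)
    identity : - (Q * Q * Q - Q) + - (Q * Q * Q + Q * Q) + (Q * Q + Q)
               ≡ - ((Q - + 1) * ((Q * Q + Q) + (Q * Q + Q)))
    identity = solve (Q ∷ [])

module ΩRegions (q : ℕ) .{{_ : ℕ.NonZero q}} (s t : ℤ) where
  open Windows (+ q) (+≤+ (ℕ.>-nonZero⁻¹ q)) s t public
  open Regions by-i by-w public

  Ω↔Region : ∀ r u → Ω q r s t u ↔ Region (- r) (- u)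
  Ω↔Region r u = mk↔ₛ′
    (λ { ((i , j , k) , r≤i , x≥ , x< , y≥ , y< , u≤w) → ((i , j , k) , (x≥ , x<) , (y≥ , y<)) , r≤i , u≤w })
    (λ { (((i , j , k) , (x≥ , x<) , (y≥ , y<)) , r≤i , u≤w) → (i , j , k) , r≤i , x≥ , x< , y≥ , y< , u≤w })
    (λ _ → refl) (λ _ → refl)

prime-power-nonZero : ∀ {q} → IsPrimePower q → ℕ.NonZero q
prime-power-nonZero (p , k , p-prime , refl) = m^n≢0 p (suc k) {{prime⇒nonZero p-prime}}

lemma2p9 : (q : ℕ) → IsPrimePower q → (r s t u : ℤ) →
    rStar q ≤ r → uStar q ≤ u →
    + 0 ≤ s → s < + q + + 1 → + 0 ≤ t → t < + q + + 1 →
    Σ ℕ λ m → Σ ℕ λ n →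
    (Fin m ↔ Ω q (rStar q) s t (uStar q)) × (Fin n ↔ Ω q r s t u)
    × (+ n ≡ + m + (r - rStar q) + (u - uStar q))
lemma2p9 q q-prime-power r s t u r*≤r u*≤u 0≤s s<q+1 0≤t t<q+1 =
  let m , n , core , whole , size = region-count lower upper (neg-mono-≤ r*≤r) (neg-mono-≤ u*≤u)
  in m , n , ↔-trans core (↔-sym (Ω↔Region (rStar q) (uStar q))) , ↔-trans whole (↔-sym (Ω↔Region r u))
   , trans size (cong₂ (λ a b → + m + a + b) (-a--b≡b-a (rStar q) r) (-a--b≡b-a (uStar q) u))
  where
  instance _ = prime-power-nonZero q-prime-power
  open ΩRegions q s t

  -a--b≡b-a : ∀ a b → - a - - b ≡ b - a
  -a--b≡b-a a b = solve (a ∷ b ∷ [])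

  lower : ∀ p → - rStar q + - uStar q ≤ Inverse.to by-i p + Inverse.to by-w p
  lower ((i , j , k) , h) = ≤-trans -r*-u*≤-[Q-1][D+D] (proj₁ (i+w-bounds 0≤s s<q+1 0≤t t<q+1 h))

  upper : ∀ p → Inverse.to by-i p + Inverse.to by-w p ≤ (+ q - + 1) * ((+ q + + 1) + (+ q + + 1))
  upper ((i , j , k) , h) = proj₂ (i+w-bounds 0≤s s<q+1 0≤t t<q+1 h)
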